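{- Let $X$ be a countably infinite set, let $z\notin X$ and $Y=X\cup\{z\}$, and let $\sigma\in S_{fin}(X)$. Then there exist finitely many swaps $h_1,\dots,h_p$ on $Y$, each forgetful or retentive, with pairwise distinct domains, such that $h_p\circ\cdots\circ h_1$ is defined on all of $Y$, agrees with $\sigma^{ -1}$ on $X$, and fixes $z$. The same holds with $\sigma$ in place of $\sigma^{ -1}$.
   Context: $S_{fin}(X)$ is the group of bijections of $X$ fixing all but finitely many elements. A swap on a set $Y$ is specified by an infinite sequence $c=(c_1,c_2,\dots)$ of pairwise distinct elements of $Y$; its domain is $\mathrm{dom}=\{c_1,c_2,\dots\}$. The forgetful swap with sequence $c$ is the map $F:Y\to Y$ with $F(c_i)=c_{i+1}$ ($i\ge1$) and $F(y)=y$ for $y\notin\mathrm{dom}$. The retentive swap with sequence $c$ is the partial map $G$ defined on $Y\setminus\{c_1\}$ by $G(c_{i+1})=c_i$ ($i\ge1$) and $G(y)=y$ for $y\notin\mathrm{dom}$; it is undefined at $c_1$. Compositions are of (partial) functions with the rightmost applied first; a composition is defined on $Y$ if at every stage the current point lies where the next map is defined. -}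

module Defs where

open import Data.Nat using (ℕ; suc)
open import Data.Maybe using (Maybe; just; nothing)
open import Data.Product using (Σ; ∃; _×_; _,_)
open import Data.Sum using (_⊎_)
open import Data.List using (List; []; _∷_)
open import Data.List.Membership.Propositional using (_∈_)
open import Data.List.Relation.Unary.AllPairs using (AllPairs)
open import Relation.Nullary using (¬_)
open import Relation.Binary.PropositionalEquality using (_≡_; _≢_)
open import Function using (_⇔_)
open import Function.Bundles using (_↔_; Inverse)
open import Function.Definitions using (Injective)

-- Y = X ∪ {z} is modelled as Maybe X, with z = nothing.

FinSupp : {X : Set} → X ↔ X → Set
FinSupp {X} σ = ∃ λ (L : List X) → ∀ x → ¬ (x ∈ L) → Inverse.to σ x ≡ x

data Kind : Set where
  forgetful retentive : Kind

-- A swap on Y: a kind and an injective sequence c = (c_1, c_2, …),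
-- indexed here from 0 (c 0 = c_1).
record Swap (Y : Set) : Set where
  field
    kind : Kind
    seq  : ℕ → Y
    inj  : Injective _≡_ _≡_ seq
open Swap public

InDom : {Y : Set} → Swap Y → Y → Set
InDom h y = ∃ λ i → seq h i ≡ y

-- graph of the (partial) map of a swap: SwapRel h y y' means h(y) is defined and equals y'
SwapRel : {Y : Set} → Swap Y → Y → Y → Set
SwapRel h y y' with kind h
... | forgetful = (∃ λ i → y ≡ seq h i × y' ≡ seq h (suc i))
                  ⊎ (¬ InDom h y × y' ≡ y)
... | retentive = (∃ λ i → y ≡ seq h (suc i) × y' ≡ seq h i)
                  ⊎ (¬ InDom h y × y' ≡ y)

-- Run (h₁ ∷ … ∷ hₚ) y y' : the composition hₚ ∘ ⋯ ∘ h₁ (h₁ applied first)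
-- is defined at y and takes value y'.
Run : {Y : Set} → List (Swap Y) → Y → Y → Set
Run [] y y' = y ≡ y'
Run (h ∷ hs) y y' = Σ _ λ y₁ → SwapRel h y y₁ × Run hs y₁ y'

DistinctDom : {Y : Set} → Swap Y → Swap Y → Set
DistinctDom h k = ¬ (∀ y → InDom h y ⇔ InDom k y)

Realizable : {X : Set} → (X → X) → Set
Realizable {X} f = ∃ λ (hs : List (Swap (Maybe X))) →
  AllPairs DistinctDom hs
  × Run hs nothing nothing
  × (∀ x → Run hs (just x) (just (f x)))

-- Enumerate Y as ℕ with z = 0. A permutation π of ℕ fixing 0 and every n ≥ B is a product of
-- transpositions: if m is the largest point moved then a = π m < m, and (a m) ∘ π fixes m.
-- With T = B + m, the transposition (a m) is the forgetful swap along a, 0, T, T+1, …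
-- followed by the retentive swap along a, m, 0, T, T+1, …: the point z = 0 is a buffer whose
-- value is passed up the tail and back. The least element ≥ B of both domains is B + m, so swaps
-- coming from different m have distinct domains, and within one pair only the second contains m.
module Submission where

open import Defs
open import Data.Nat using (ℕ; zero; suc; _+_; _∸_; _≤_; _<_; _≟_; _≤?_; z≤n; s≤s)
open import Data.Nat.Properties
open import Data.Maybe using (Maybe; just; nothing)
open import Data.Maybe.Properties using (just-injective)
open import Data.Product using (Σ; ∃; _×_; _,_)
open import Data.Sum using (_⊎_; inj₁; inj₂)
import Data.Sum as Sum
open import Data.List using (List; []; _∷_; _++_; map)
open import Data.List.Relation.Unary.All as All using (All; []; _∷_)
open import Data.List.Relation.Unary.All.Properties using (All¬⇒¬Any; ++⁺)
open import Data.List.Relation.Unary.AllPairs as AllPairs using (AllPairs; []; _∷_)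
import Data.List.Relation.Unary.AllPairs.Properties as AllPairsₚ
open import Data.List.Relation.Unary.Any using (here; there)
open import Data.List.Membership.Propositional using (_∈_)
open import Data.List.Membership.Propositional.Properties using (∈-map⁺)
open import Data.List.Extrema.Nat using (max; xs≤max)
open import Relation.Nullary using (¬_; yes; no; contradiction)
open import Relation.Binary.PropositionalEquality
open import Function using (_∘_; Equivalence)
open import Function.Bundles using (_↔_; Inverse; Injection)
open import Function.Definitions using (Injective)
open import Function.Properties.Inverse using (↔-sym; Inverse⇒Injection)

prefixed : List ℕ → ℕ → ℕ → ℕ
prefixed []       T i       = T + i
prefixed (x ∷ xs) T zero    = x
prefixed (x ∷ xs) T (suc i) = prefixed xs T i

prefixed-∈⊎≥ : ∀ xs T i → prefixed xs T i ∈ xs ⊎ T ≤ prefixed xs T i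
prefixed-∈⊎≥ []       T i       = inj₂ (m≤m+n T i)
prefixed-∈⊎≥ (x ∷ xs) T zero    = inj₁ (here refl)
prefixed-∈⊎≥ (x ∷ xs) T (suc i) = Sum.map₁ there (prefixed-∈⊎≥ xs T i)

prefixed-∌ : ∀ {y xs T} → All (y ≢_) xs → y < T → ¬ (∃ λ i → prefixed xs T i ≡ y)
prefixed-∌ {xs = xs} {T} y∉xs y<T (i , eq) with prefixed-∈⊎≥ xs T i
... | inj₁ p = All¬⇒¬Any y∉xs (subst (_∈ xs) eq p)
... | inj₂ q = <⇒≱ y<T (subst (T ≤_) eq q)

prefixed-injective : ∀ xs T → AllPairs _≢_ xs → All (_< T) xs →
                     Injective _≡_ _≡_ (prefixed xs T)
prefixed-injective []       T _ _ {i} {j} eq = +-cancelˡ-≡ T i j eq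
prefixed-injective (x ∷ xs) T _ _ {zero} {zero} _ = refl
prefixed-injective (x ∷ xs) T (x∉xs ∷ _) (x<T ∷ _) {zero} {suc j} eq =
  contradiction (j , sym eq) (prefixed-∌ x∉xs x<T)
prefixed-injective (x ∷ xs) T (x∉xs ∷ _) (x<T ∷ _) {suc i} {zero} eq =
  contradiction (i , eq) (prefixed-∌ x∉xs x<T)
prefixed-injective (x ∷ xs) T (_ ∷ distinct) (_ ∷ below) {suc i} {suc j} eq =
  cong suc (prefixed-injective xs T distinct below eq)

prefixedSwap : Kind → (xs : List ℕ) (T : ℕ) → AllPairs _≢_ xs → All (_< T) xs → Swap ℕ
prefixedSwap k xs T distinct below = record
  { kind = k ; seq = prefixed xs T ; inj = prefixed-injective xs T distinct below }

transpose : ℕ → ℕ → ℕ → ℕ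
transpose a b x with x ≟ a
... | yes _ = b
... | no _ with x ≟ b
...   | yes _ = a
...   | no _  = x

transpose-a : ∀ a b → transpose a b a ≡ b
transpose-a a b with a ≟ a
... | yes _   = refl
... | no a≢a  = contradiction refl a≢a

transpose-b : ∀ a b → transpose a b b ≡ a
transpose-b a b with b ≟ a
... | yes b≡a = b≡a
... | no _ with b ≟ b
...   | yes _   = refl
...   | no b≢b  = contradiction refl b≢b

transpose-other : ∀ {a b x} → x ≢ a → x ≢ b → transpose a b x ≡ x
transpose-other {a} {b} {x} x≢a x≢b with x ≟ a
... | yes x≡a = contradiction x≡a x≢a
... | no _ with x ≟ b
...   | yes x≡b = contradiction x≡b x≢b
...   | no _    = refl

transpose-involutive : ∀ a b x → transpose a b (transpose a b x) ≡ x
transpose-involutive a b x with x ≟ a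
... | yes refl = transpose-b a b
... | no x≢a with x ≟ b
...   | yes refl = transpose-a a b
...   | no x≢b   = transpose-other x≢a x≢b

transpose-injective : ∀ a b → Injective _≡_ _≡_ (transpose a b)
transpose-injective a b {x} {y} eq = begin
  x                                     ≡⟨ transpose-involutive a b x ⟨
  transpose a b (transpose a b x)       ≡⟨ cong (transpose a b) eq ⟩
  transpose a b (transpose a b y)       ≡⟨ transpose-involutive a b y ⟩
  y                                     ∎
  where open ≡-Reasoning

Run-++ : ∀ {Y : Set} (hs ks : List (Swap Y)) {x y w} → Run hs x y → Run ks y w → Run (hs ++ ks) x w
Run-++ []       ks refl         r = r
Run-++ (h ∷ hs) ks (y , s , rs) r = y , s , Run-++ hs ks rs r

data Separated {Y : Set} (h k : Swap Y) : Set where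
  only-left  : ∀ y → InDom h y → ¬ InDom k y → Separated h k
  only-right : ∀ y → ¬ InDom h y → InDom k y → Separated h k

Separated⇒DistinctDom : ∀ {Y : Set} {h k : Swap Y} → Separated h k → DistinctDom h k
Separated⇒DistinctDom (only-left  y y∈h y∉k) same = y∉k (Equivalence.to (same y) y∈h)
Separated⇒DistinctDom (only-right y y∉h y∈k) same = y∉h (Equivalence.from (same y) y∈k)

record EntersAt (B m : ℕ) (h : Swap ℕ) : Set where
  constructor entersAt
  field
    entry : InDom h (B + m)
    gap   : ∀ y → B ≤ y → y < B + m → ¬ InDom h y

EntersAt-separated : ∀ {B m m' h k} → m' < m → EntersAt B m' h → EntersAt B m k → Separated h k
EntersAt-separated {B} {m' = m'} m'<m (entersAt entry _) (entersAt _ gap) =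
  only-left (B + m') entry (gap (B + m') (m≤m+n B m') (+-monoʳ-< B m'<m))

module TranspositionBySwaps (B m a : ℕ) (0<a : 0 < a) (a<m : a < m) (m<B : m < B) where

  T : ℕ
  T = B + m

  a<B : a < B
  a<B = <-trans a<m m<B

  B≤T : B ≤ T
  B≤T = m≤m+n B m

  a≢0 : a ≢ 0
  a≢0 = >⇒≢ 0<a

  m≢0 : m ≢ 0
  m≢0 = >⇒≢ (<-trans 0<a a<m)

  0<T : 0 < T
  0<T = <-≤-trans (<-trans 0<a a<B) B≤T

  a<T : a < T
  a<T = <-≤-trans a<B B≤T

  m<T : m < T
  m<T = <-≤-trans m<B B≤T

  F : Swap ℕ
  F = prefixedSwap forgetful (a ∷ 0 ∷ []) T ((a≢0 ∷ []) ∷ [] ∷ []) (a<T ∷ 0<T ∷ [])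

  G : Swap ℕ
  G = prefixedSwap retentive (a ∷ m ∷ 0 ∷ []) T
        ((<⇒≢ a<m ∷ a≢0 ∷ []) ∷ (m≢0 ∷ []) ∷ [] ∷ []) (a<T ∷ m<T ∷ 0<T ∷ [])

  run-a : Run (F ∷ G ∷ []) a m
  run-a = 0 , inj₁ (0 , refl , refl) , m , inj₁ (1 , refl , refl) , refl

  run-m : Run (F ∷ G ∷ []) m a
  run-m = m , inj₂ (prefixed-∌ (≢-sym (<⇒≢ a<m) ∷ m≢0 ∷ []) m<T , refl)
            , a , inj₁ (0 , refl , refl) , refl

  run-0 : Run (F ∷ G ∷ []) 0 0
  run-0 = T + 0 , inj₁ (1 , refl , refl) , 0 , inj₁ (2 , refl , refl) , refl

  run-tail : ∀ k → Run (F ∷ G ∷ []) (T + k) (T + k)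
  run-tail k = T + suc k , inj₁ (2 + k , refl , refl) , T + k , inj₁ (3 + k , refl , refl) , refl

  run-below : ∀ {x} → x ≢ a → x ≢ m → x ≢ 0 → x < T → Run (F ∷ G ∷ []) x x
  run-below x≢a x≢m x≢0 x<T =
    _ , inj₂ (prefixed-∌ (x≢a ∷ x≢0 ∷ []) x<T , refl) ,
    _ , inj₂ (prefixed-∌ (x≢a ∷ x≢m ∷ x≢0 ∷ []) x<T , refl) , refl

  run-fixed : ∀ {x} → x ≢ a → x ≢ m → Run (F ∷ G ∷ []) x x
  run-fixed {x} x≢a x≢m with x ≟ 0 | T ≤? x
  ... | yes refl | _       = run-0
  ... | no _     | yes T≤x =
    subst (λ y → Run (F ∷ G ∷ []) y y) (m+[n∸m]≡n T≤x) (run-tail (x ∸ T))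
  ... | no x≢0   | no T≰x  = run-below x≢a x≢m x≢0 (≰⇒> T≰x)

  transposition-run : ∀ x → Run (F ∷ G ∷ []) x (transpose a m x)
  transposition-run x with x ≟ a
  ... | yes refl = run-a
  ... | no x≢a with x ≟ m
  ...   | yes refl = run-m
  ...   | no x≢m   = run-fixed x≢a x≢m

  above-B-≢ : ∀ {y c} → B ≤ y → c < B → y ≢ c
  above-B-≢ B≤y c<B = >⇒≢ (<-≤-trans c<B B≤y)

  F-entersAt : EntersAt B m F
  F-entersAt = entersAt (2 , +-identityʳ T) λ y B≤y y<T →
    prefixed-∌ (above-B-≢ B≤y a<B ∷ above-B-≢ B≤y (<-trans 0<a a<B) ∷ []) y<T

  G-entersAt : EntersAt B m G
  G-entersAt = entersAt (3 , +-identityʳ T) λ y B≤y y<T →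
    prefixed-∌ (above-B-≢ B≤y a<B ∷ above-B-≢ B≤y m<B ∷ above-B-≢ B≤y (<-trans 0<a a<B) ∷ [])
               y<T

  F-G-separated : Separated F G
  F-G-separated = only-right m (prefixed-∌ (≢-sym (<⇒≢ a<m) ∷ m≢0 ∷ []) m<T) (1 , refl)

FixedFrom : ℕ → (ℕ → ℕ) → Set
FixedFrom N π = ∀ n → N ≤ n → π n ≡ n

FixedFrom-pred : ∀ {m π} → FixedFrom (suc m) π → π m ≡ m → FixedFrom m π
FixedFrom-pred fix πm≡m n m≤n with m≤n⇒m<n∨m≡n m≤n
... | inj₁ m<n  = fix n m<n
... | inj₂ refl = πm≡m

moved-< : ∀ {m π} → Injective _≡_ _≡_ π → FixedFrom (suc m) π → π m ≢ m → π m < m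
moved-< {m} {π} π-inj fix πm≢m with suc m ≤? π m
... | yes m<πm = contradiction (π-inj (fix (π m) m<πm)) πm≢m
... | no m≮πm  = ≤∧≢⇒< (≤-pred (≰⇒> m≮πm)) πm≢m

moved-positive : ∀ {m π} → Injective _≡_ _≡_ π → π 0 ≡ 0 → π m ≢ m → 0 < π m
moved-positive {m} {π} π-inj π0≡0 πm≢m = n≢0⇒n>0 λ πm≡0 →
  πm≢m (trans πm≡0 (π-inj (trans π0≡0 (sym πm≡0))))

transpose-moved-FixedFrom : ∀ {m π} → FixedFrom (suc m) π → π m < m →
                            FixedFrom m (transpose (π m) m ∘ π)
transpose-moved-FixedFrom {m} {π} fix πm<m n m≤n with m≤n⇒m<n∨m≡n m≤n
... | inj₁ m<n  = trans (cong (transpose (π m) m) (fix n m<n))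
                        (transpose-other (>⇒≢ (<-trans πm<m m<n)) (>⇒≢ m<n))
... | inj₂ refl = transpose-a (π m) m

module Sorting (B : ℕ) where

  record EntersBelow (N : ℕ) (h : Swap ℕ) : Set where
    constructor entersBelow
    field
      m     : ℕ
      m<N   : m < N
      enter : EntersAt B m h

  Realization : ℕ → (ℕ → ℕ) → Set
  Realization N π = Σ (List (Swap ℕ)) λ hs →
    AllPairs Separated hs × All (EntersBelow N) hs × (∀ n → Run hs n (π n))

  EntersBelow-suc : ∀ {N h} → EntersBelow N h → EntersBelow (suc N) h
  EntersBelow-suc (entersBelow m m<N enter) = entersBelow m (m<n⇒m<1+n m<N) enter

  Realization-suc : ∀ {N π} → Realization N π → Realization (suc N) π
  Realization-suc (hs , sep , entries , runs) = hs , sep , All.map EntersBelow-suc entries , runs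

  realization : ∀ N → N ≤ B → ∀ π → Injective _≡_ _≡_ π → π 0 ≡ 0 → FixedFrom N π →
                Realization N π
  realization zero    _   π _     _    fix = [] , [] , [] , λ n → sym (fix n z≤n)
  realization (suc m) m<B π π-inj π0≡0 fix with π m ≟ m
  ... | yes πm≡m =
    Realization-suc (realization m (<⇒≤ m<B) π π-inj π0≡0 (FixedFrom-pred fix πm≡m))
  ... | no πm≢m  = extend (realization m (<⇒≤ m<B) ρ ρ-injective ρ0≡0 ρ-fixed)
    where
    a : ℕ
    a = π m

    a<m : a < m
    a<m = moved-< π-inj fix πm≢m

    0<a : 0 < a
    0<a = moved-positive π-inj π0≡0 πm≢m

    open TranspositionBySwaps B m a 0<a a<m m<B

    ρ : ℕ → ℕ
    ρ = transpose a m ∘ π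

    ρ-injective : Injective _≡_ _≡_ ρ
    ρ-injective eq = π-inj (transpose-injective a m eq)

    ρ0≡0 : ρ 0 ≡ 0
    ρ0≡0 = trans (cong (transpose a m) π0≡0) (transpose-other (≢-sym a≢0) (≢-sym m≢0))

    ρ-fixed : FixedFrom m ρ
    ρ-fixed = transpose-moved-FixedFrom fix a<m

    separated-from-FG : ∀ {h} → EntersBelow m h → All (Separated h) (F ∷ G ∷ [])
    separated-from-FG (entersBelow _ m'<m enter) =
      EntersAt-separated m'<m enter F-entersAt ∷ EntersAt-separated m'<m enter G-entersAt ∷ []

    extend : Realization m ρ → Realization (suc m) π
    extend (hs , sep , entries , runs) =
      hs ++ F ∷ G ∷ [] ,
      AllPairsₚ.++⁺ sep ((F-G-separated ∷ []) ∷ [] ∷ []) (All.map separated-from-FG entries) ,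
      ++⁺ (All.map EntersBelow-suc entries)
          (entersBelow m ≤-refl F-entersAt ∷ entersBelow m ≤-refl G-entersAt ∷ []) ,
      λ n → subst (Run (hs ++ F ∷ G ∷ []) n) (transpose-involutive a m (π n))
                  (Run-++ hs (F ∷ G ∷ []) (runs n) (transposition-run (ρ n)))

module Transport {A Y : Set} (φ : A → Y) (φ-injective : Injective _≡_ _≡_ φ) where

  mapSwap : Swap A → Swap Y
  mapSwap h = record { kind = kind h ; seq = φ ∘ seq h ; inj = λ eq → inj h (φ-injective eq) }

  InDom-map : ∀ h {u} → InDom h u → InDom (mapSwap h) (φ u)
  InDom-map h (i , eq) = i , cong φ eq

  ¬InDom-map : ∀ h {u} → ¬ InDom h u → ¬ InDom (mapSwap h) (φ u)
  ¬InDom-map h u∉h (i , eq) = u∉h (i , φ-injective eq)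

  SwapRel-map : ∀ h {u v} → SwapRel h u v → SwapRel (mapSwap h) (φ u) (φ v)
  SwapRel-map h r with kind h
  SwapRel-map h (inj₁ (i , p , q)) | forgetful = inj₁ (i , cong φ p , cong φ q)
  SwapRel-map h (inj₂ (n , q))     | forgetful = inj₂ (¬InDom-map h n , cong φ q)
  SwapRel-map h (inj₁ (i , p , q)) | retentive = inj₁ (i , cong φ p , cong φ q)
  SwapRel-map h (inj₂ (n , q))     | retentive = inj₂ (¬InDom-map h n , cong φ q)

  Run-map : ∀ hs {u v} → Run hs u v → Run (map mapSwap hs) (φ u) (φ v)
  Run-map []       eq           = cong φ eq
  Run-map (h ∷ hs) (y , r , rs) = φ y , SwapRel-map h r , Run-map hs rs

  Separated-map : ∀ {h k} → Separated h k → Separated (mapSwap h) (mapSwap k)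
  Separated-map {h} {k} (only-left  y y∈h y∉k) =
    only-left  (φ y) (InDom-map h y∈h) (¬InDom-map k y∉k)
  Separated-map {h} {k} (only-right y y∉h y∈k) =
    only-right (φ y) (¬InDom-map h y∉h) (InDom-map k y∈k)

  DistinctDom-map : ∀ {hs} → AllPairs Separated hs → AllPairs DistinctDom (map mapSwap hs)
  DistinctDom-map sep = AllPairsₚ.map⁺ (AllPairs.map (Separated⇒DistinctDom ∘ Separated-map) sep)

↔-injective : ∀ {A B : Set} (e : A ↔ B) → Injective _≡_ _≡_ (Inverse.to e)
↔-injective e = Injection.injective (Inverse⇒Injection e)

FinSupp-↔-sym : ∀ {X : Set} (σ : X ↔ X) → FinSupp σ → FinSupp (↔-sym σ)
FinSupp-↔-sym σ (L , fixed) = L , λ x x∉L →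
  trans (cong (Inverse.from σ) (sym (fixed x x∉L))) (Inverse.strictlyInverseʳ σ x)

module Enumerated {X : Set} (e : ℕ ↔ X) where
  open Inverse e using (to; from; strictlyInverseˡ; strictlyInverseʳ)

  embed : ℕ → Maybe X
  embed zero    = nothing
  embed (suc n) = just (to n)

  embed-injective : Injective _≡_ _≡_ embed
  embed-injective {zero}  {zero}  _  = refl
  embed-injective {suc i} {suc j} eq = cong suc (↔-injective e (just-injective eq))

  conjugate : (X → X) → ℕ → ℕ
  conjugate f zero    = zero
  conjugate f (suc n) = suc (from (f (to n)))

  conjugate-injective : ∀ {f} → Injective _≡_ _≡_ f → Injective _≡_ _≡_ (conjugate f)
  conjugate-injective         f-inj {zero}  {zero}  _  = refl
  conjugate-injective {f = f} f-inj {suc i} {suc j} eq = cong suc (begin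
    i                  ≡⟨ strictlyInverseʳ i ⟨
    from (to i)        ≡⟨ cong from (f-inj (↔-injective (↔-sym e) (suc-injective eq))) ⟩
    from (to j)        ≡⟨ strictlyInverseʳ j ⟩
    j                  ∎)
    where open ≡-Reasoning

  bound : List X → ℕ
  bound L = suc (suc (max 0 (map from L)))

  conjugate-FixedFrom : ∀ {f} L → (∀ x → ¬ x ∈ L → f x ≡ x) →
                        FixedFrom (bound L) (conjugate f)
  conjugate-FixedFrom {f} L fixed (suc k) (s≤s max<k) =
    cong suc (trans (cong from (fixed (to k) to-k∉L)) (strictlyInverseʳ k))
    where
    to-k∉L : ¬ to k ∈ L
    to-k∉L p = <⇒≱ max<k (subst (_≤ max 0 (map from L)) (strictlyInverseʳ k)
                                 (All.lookup (xs≤max 0 (map from L)) (∈-map⁺ from p)))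

  embed-conjugate : ∀ f x → embed (conjugate f (suc (from x))) ≡ just (f x)
  embed-conjugate f x = cong just (trans (strictlyInverseˡ _) (cong f (strictlyInverseˡ x)))

  realizable : (σ : X ↔ X) → FinSupp σ → Realizable (Inverse.to σ)
  realizable σ (L , fixed) = transport
    (realization (bound L) ≤-refl (conjugate f)
      (conjugate-injective (↔-injective σ)) refl (conjugate-FixedFrom L fixed))
    where
    f : X → X
    f = Inverse.to σ
    open Transport embed embed-injective
    open Sorting (bound L)
    transport : Realization (bound L) (conjugate f) → Realizable f
    transport (hs , sep , _ , runs) =
      map mapSwap hs , DistinctDom-map sep , Run-map hs (runs 0) ,
      λ x → subst₂ (Run (map mapSwap hs)) (cong just (strictlyInverseˡ x)) (embed-conjugate f x)
                   (Run-map hs (runs (suc (from x))))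

mainTheorem16 : (X : Set) → ℕ ↔ X → (σ : X ↔ X) → FinSupp σ →
    Realizable (Inverse.from σ) × Realizable (Inverse.to σ)
mainTheorem16 X e σ finite = realizable (↔-sym σ) (FinSupp-↔-sym σ finite) , realizable σ finite
  where open Enumerated e
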